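{- Let $\pi=\pi_1\cdots\pi_n$ be a permutation. If there is an index $\ell\in[n-2]$ such that $\pi_{\ell+1}<\pi_{\ell+2}<\pi_\ell$, then $\pi$ is not uniquely sorted.
   Context: A permutation is a permutation of a finite set of positive integers written in one-line notation. West's stack-sorting map $s$ is defined as follows: given an input permutation $\pi=\pi_1\cdots\pi_n$, process it with an initially empty vertical stack; at each step, if the stack is empty or the next entry of the input is smaller than the entry at the top of the stack, push the next input entry onto the stack; otherwise pop the top entry of the stack and append it to the end of the output. When the output has length $n$, this output is $s(\pi)$. A permutation $\pi$ is uniquely sorted if there is exactly one permutation $\mu$ with $s(\mu)=\pi$. -}

module Defs where

open import Data.Nat using (ℕ; _<_; _<ᵇ_)
open import Data.Bool using (if_then_else_)
open import Data.List using (List; []; _∷_; _++_)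
open import Data.List.Relation.Unary.All using (All)
open import Data.List.Relation.Unary.Unique.Propositional using (Unique)
open import Data.Product using (_×_; Σ; ∃-syntax)
open import Relation.Binary.PropositionalEquality using (_≡_)

-- A permutation (of a finite set of positive integers) in one-line notation:
-- a list of distinct positive integers.
IsPermutation : List ℕ → Set
IsPermutation π = Unique π × All (λ x → 0 < x) π

-- West's stack-sorting map, simulated literally.
-- stackSort input stack = output produced from the current state
-- (stack written top first).
stackSort : List ℕ → List ℕ → List ℕ
stackSort []       stack    = stack
stackSort (x ∷ xs) []       = stackSort xs (x ∷ [])
stackSort (x ∷ xs) (t ∷ ts) =
  if x <ᵇ t then stackSort xs (x ∷ t ∷ ts)
            else t ∷ stackSort (x ∷ xs) ts

s : List ℕ → List ℕ
s π = stackSort π []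

UniquelySorted : List ℕ → Set
UniquelySorted π =
  Σ (List ℕ) λ μ → IsPermutation μ × s μ ≡ π ×
    ((ν : List ℕ) → IsPermutation ν → s ν ≡ π → ν ≡ μ)

module Submission where

-- Write μ = L ++ m ∷ R with m the largest entry of μ.  West's
-- map then satisfies  s(L m R) = s(L) s(R) m,  so the distinct entries of μ
-- carry the structure of a decreasing binary tree (m at the root, L and R the
-- subtrees), of which s(μ) is the postorder reading.
--
-- Twins propagate from
-- L or R to L ++ m ∷ R.  Two local facts produce twins: an ascent b < c at
-- the very start of s μ, and, in the main lemma, a window a b c of s μ with
-- b < c < a (the ascent b c then starts the output of some right subtree).
-- The last two entries of s μ always ascend, which rules out the remaining
-- position of the window.  The corollary follows: a twin of a preimage of π
-- is a second preimage, so π is not uniquely sorted.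

open import Defs
open import Data.Nat using (ℕ; _<_; _≤_; _<ᵇ_)
open import Data.Nat.Properties using (<⇒<ᵇ; <ᵇ⇒<; <-trans; <-≤-trans; ≤-trans; <⇒≤; ≤-refl; ≤⇒≯; <⇒≢; <-asym; <-cmp)
open import Data.Bool using (Bool; true; false; T; if_then_else_)
open import Data.Bool.Properties using (T-≡)
open import Data.Unit using (⊤; tt)
open import Data.Empty using (⊥-elim)
open import Data.List using (List; []; _∷_; _++_; _∷ʳ_)
open import Data.List.Properties using (++-assoc; ++-identityʳ; ∷-injective; ∷-injectiveˡ; ∷-injectiveʳ; ++-cancelˡ; ++-cancelʳ; ∷ʳ-injective)
open import Data.List.Relation.Unary.All as All using (All; []; _∷_)
open import Data.List.Relation.Unary.All.Properties using (++⁺; ++⁻ˡ; ++⁻ʳ)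
open import Data.List.Relation.Unary.Unique.Propositional using (Unique; []; _∷_)
open import Data.List.Relation.Binary.Permutation.Propositional using (_↭_; prep; swap; ↭-refl; ↭-sym; ↭-trans; ↭⇒↭ₛ)
open import Data.List.Relation.Binary.Permutation.Propositional.Properties using (shift; ++⁺ʳ; ++⁺ˡ; All-resp-↭; ↭-empty-inv; ↭-singleton-inv)
open import Data.List.Relation.Binary.Permutation.Setoid.Properties using (Unique-resp-↭)
open import Data.Product using (_×_; Σ; ∃-syntax; _,_)
open import Data.Sum using (_⊎_; inj₁; inj₂)
open import Function.Bundles using (Equivalence)
open import Relation.Binary.PropositionalEquality
open import Relation.Binary.Definitions using (tri<; tri≈; tri>)
open import Relation.Nullary using (¬_)

OnHead : (ℕ → Set) → List ℕ → Set
OnHead P []      = ⊤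
OnHead P (x ∷ _) = P x

OnHead-prefix : ∀ {P} xs {ys} → OnHead P (xs ++ ys) → OnHead P xs
OnHead-prefix []      _  = tt
OnHead-prefix (_ ∷ _) Px = Px

OnHead-++ : ∀ {P} xs {ys} → OnHead P xs → OnHead P ys → OnHead P (xs ++ ys)
OnHead-++ []      _  Py = Py
OnHead-++ (_ ∷ _) Px _  = Px

below-head-∷ʳ : ∀ {b m} xs → All (_< m) xs → OnHead (b <_) (xs ∷ʳ m) → b < m
below-head-∷ʳ []       []        b<m = b<m
below-head-∷ʳ (_ ∷ _)  (x<m ∷ _) b<x = <-trans b<x x<m

<ᵇ-true : ∀ {x y} → x < y → (x <ᵇ y) ≡ true
<ᵇ-true x<y = Equivalence.to T-≡ (<⇒<ᵇ x<y)

<ᵇ-false : ∀ {x y} → y ≤ x → (x <ᵇ y) ≡ false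
<ᵇ-false {x} {y} y≤x with x <ᵇ y in eq
... | false = refl
... | true  = ⊥-elim (≤⇒≯ y≤x (<ᵇ⇒< x y (subst T (sym eq) tt)))

if-++ : ∀ (x<t : Bool) {xs ys xs′ ys′ zs : List ℕ} → xs′ ≡ xs ++ zs → ys′ ≡ ys ++ zs →
  (if x<t then xs′ else ys′) ≡ (if x<t then xs else ys) ++ zs
if-++ true  eq _ = eq
if-++ false _ eq = eq

-- Entries below a bound B never interact with entries ≥ B: if the input w and
-- the upper stack part st are below B while the remaining input and the lower
-- stack start at ≥ B, then w and st are sorted away completely first.
stackSort-++ : ∀ B w st rest stk → All (_< B) w → All (_< B) st →
  OnHead (B ≤_) rest → OnHead (B ≤_) stk →
  stackSort (w ++ rest) (st ++ stk) ≡ stackSort w st ++ stackSort rest stk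
stackSort-++ B [] [] rest stk _ _ _ _ = refl
stackSort-++ B [] (y ∷ ys) [] stk _ _ _ _ = refl
stackSort-++ B [] (y ∷ ys) (r ∷ rs) stk _ (y<B ∷ ys<B) B≤r B≤stk
  rewrite <ᵇ-false {r} {y} (≤-trans (<⇒≤ y<B) B≤r) =
  cong (y ∷_) (stackSort-++ B [] ys (r ∷ rs) stk [] ys<B B≤r B≤stk)
stackSort-++ B (x ∷ xs) [] rest [] (x<B ∷ xs<B) _ B≤rest _ =
  stackSort-++ B xs (x ∷ []) rest [] xs<B (x<B ∷ []) B≤rest tt
stackSort-++ B (x ∷ xs) [] rest (t ∷ ts) (x<B ∷ xs<B) _ B≤rest B≤t
  rewrite <ᵇ-true (<-≤-trans x<B B≤t) =
  stackSort-++ B xs (x ∷ []) rest (t ∷ ts) xs<B (x<B ∷ []) B≤rest B≤t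
stackSort-++ B (x ∷ xs) (y ∷ ys) rest stk (x<B ∷ xs<B) (y<B ∷ ys<B) B≤rest B≤stk
  = if-++ (x <ᵇ y)
      (stackSort-++ B xs (x ∷ y ∷ ys) rest stk xs<B (x<B ∷ y<B ∷ ys<B) B≤rest B≤stk)
      (cong (y ∷_) (stackSort-++ B (x ∷ xs) ys rest stk (x<B ∷ xs<B) ys<B B≤rest B≤stk))

s-split : ∀ L m R → All (_< m) L → All (_< m) R → s (L ++ m ∷ R) ≡ s L ++ s R ++ m ∷ []
s-split L m R L<m R<m = begin
  s (L ++ m ∷ R)                ≡⟨ stackSort-++ m L [] (m ∷ R) [] L<m [] ≤-refl tt ⟩
  s L ++ stackSort R (m ∷ [])   ≡⟨ cong (λ r → s L ++ stackSort r (m ∷ [])) (sym (++-identityʳ R)) ⟩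
  s L ++ stackSort (R ++ []) (m ∷ [])
    ≡⟨ cong (s L ++_) (stackSort-++ m R [] [] (m ∷ []) R<m [] tt ≤-refl) ⟩
  s L ++ s R ++ m ∷ []          ∎
  where open ≡-Reasoning

s-split-∷ʳ : ∀ L m R → All (_< m) L → All (_< m) R → s (L ++ m ∷ R) ≡ (s L ++ s R) ∷ʳ m
s-split-∷ʳ L m R L<m R<m = trans (s-split L m R L<m R<m) (sym (++-assoc (s L) (s R) (m ∷ [])))

if-↭ : ∀ (x<t : Bool) {xs ys zs : List ℕ} → xs ↭ zs → ys ↭ zs → (if x<t then xs else ys) ↭ zs
if-↭ true  p _ = p
if-↭ false _ q = q

stackSort-↭ : ∀ xs st → stackSort xs st ↭ xs ++ st
stackSort-↭ []       st       = ↭-refl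
stackSort-↭ (x ∷ xs) []       = ↭-trans (stackSort-↭ xs (x ∷ [])) (shift x xs [])
stackSort-↭ (x ∷ xs) (t ∷ ts) = if-↭ (x <ᵇ t)
  (↭-trans (stackSort-↭ xs (x ∷ t ∷ ts)) (shift x xs (t ∷ ts)))
  (↭-trans (prep t (stackSort-↭ (x ∷ xs) ts)) (↭-sym (shift t (x ∷ xs) ts)))

s-↭ : ∀ xs → s xs ↭ xs
s-↭ xs = subst (s xs ↭_) (++-identityʳ xs) (stackSort-↭ xs [])

s-bounded : ∀ {m} xs → All (_< m) xs → All (_< m) (s xs)
s-bounded xs xs<m = All-resp-↭ (↭-sym (s-↭ xs)) xs<m

s-empty : ∀ xs → s xs ≡ [] → xs ≡ []
s-empty xs eq = ↭-empty-inv (subst (xs ↭_) eq (↭-sym (s-↭ xs)))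

s-singleton : ∀ xs {x} → s xs ≡ x ∷ [] → xs ≡ x ∷ []
s-singleton xs eq = ↭-singleton-inv (subst (xs ↭_) eq (↭-sym (s-↭ xs)))

s-subtrees-below : ∀ L m R → All (_< m) L → All (_< m) R → All (_< m) (s L ++ s R)
s-subtrees-below L m R L<m R<m = ++⁺ (s-bounded L L<m) (s-bounded R R<m)

IsPermutation-resp-↭ : ∀ {xs ys} → xs ↭ ys → IsPermutation xs → IsPermutation ys
IsPermutation-resp-↭ p (unique , positive) =
  Unique-resp-↭ (setoid ℕ) (↭⇒↭ₛ p) unique , All-resp-↭ p positive

-- The decreasing binary tree of a list of distinct entries, as a view: a
-- list is empty, or L ++ m ∷ R with m above every entry of L and of R.
data MaxTree : List ℕ → Set where
  leaf : MaxTree []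
  node : ∀ {L R} → MaxTree L → (m : ℕ) → MaxTree R →
         All (_< m) L → All (_< m) R → MaxTree (L ++ m ∷ R)

-- Adding a new entry in front: it descends the leftmost branch until it
-- meets a smaller root, and takes that root's place.
cons-tree : ∀ x {xs} → All (x ≢_) xs → MaxTree xs → MaxTree (x ∷ xs)
cons-tree x _ leaf = node leaf x leaf [] []
cons-tree x x∉ (node {L} {R} tL m tR L<m R<m) with <-cmp x m
... | tri< x<m _ _ = node (cons-tree x (++⁻ˡ L x∉) tL) m tR (x<m ∷ L<m) R<m
... | tri> _ _ m<x = node leaf x (node tL m tR L<m R<m) []
                       (++⁺ (All.map (λ y<m → <-trans y<m m<x) L<m)
                            (m<x ∷ All.map (λ y<m → <-trans y<m m<x) R<m))
... | tri≈ _ x≡m _ with ++⁻ʳ L x∉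
...   | x≢m ∷ _ = ⊥-elim (x≢m x≡m)

maxTree : ∀ {xs} → Unique xs → MaxTree xs
maxTree {[]}     []          = leaf
maxTree {x ∷ xs} (x∉ ∷ uniq) = cons-tree x x∉ (maxTree uniq)

-- In every output of s, the last two entries form an ascent: the last entry
-- is the maximum.
last-ascent : ∀ {μ} → MaxTree μ → ∀ p {a b} → s μ ≡ p ++ a ∷ b ∷ [] → a < b
last-ascent leaf [] ()
last-ascent leaf (_ ∷ _) ()
last-ascent (node {L} {R} _ m _ L<m R<m) p {a} {b} eq
  with ∷ʳ-injective (s L ++ s R) (p ∷ʳ a)
         (trans (sym (s-split-∷ʳ L m R L<m R<m)) (trans eq (sym (++-assoc p (a ∷ []) (b ∷ [])))))
... | p∷a≡ , refl with ++⁻ʳ p (subst (All (_< m)) p∷a≡ (s-subtrees-below L m R L<m R<m))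
...   | a<m ∷ [] = a<m

-- If b is smaller than the first output of ρ, it is also smaller than the
-- first entry of ρ: the first entry popped is at most the first one pushed.
head-below : ∀ {ρ b} → MaxTree ρ → OnHead (b <_) (s ρ) → OnHead (b <_) ρ
head-below leaf _ = tt
head-below {b = b} (node {L} {R} tL m _ L<m R<m) b<sρ =
  OnHead-++ {P = b <_} L (head-below tL b<sL) b<m
  where
  b<out : OnHead (b <_) ((s L ++ s R) ∷ʳ m)
  b<out = subst (OnHead (b <_)) (s-split-∷ʳ L m R L<m R<m) b<sρ
  b<sL : OnHead (b <_) (s L)
  b<sL = OnHead-prefix {P = b <_} (s L) (OnHead-prefix {P = b <_} (s L ++ s R) b<out)
  b<m : b < m
  b<m = below-head-∷ʳ (s L ++ s R) (s-subtrees-below L m R L<m R<m) b<out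

-- An entry below the first entry of ρ is pushed and popped at once.
s-cons : ∀ {b} ρ → OnHead (b <_) ρ → s (b ∷ ρ) ≡ b ∷ s ρ
s-cons []      _   = refl
s-cons {b} (x ∷ _) b<x rewrite <ᵇ-false {x} {b} (<⇒≤ b<x) = refl

s-swap-front : ∀ {b m} R → b < m → All (_< m) R → OnHead (b <_) R →
  s (m ∷ b ∷ R) ≡ s (b ∷ m ∷ R)
s-swap-front {b} {m} R b<m R<m b<R = begin
  s ([] ++ m ∷ b ∷ R)     ≡⟨ s-split [] m (b ∷ R) [] (b<m ∷ R<m) ⟩
  s (b ∷ R) ++ m ∷ []     ≡⟨ cong (_++ m ∷ []) (s-cons R b<R) ⟩
  b ∷ s R ++ m ∷ []       ≡⟨ s-split (b ∷ []) m R (b<m ∷ []) R<m ⟨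
  s ((b ∷ []) ++ m ∷ R)   ∎
  where open ≡-Reasoning

Twin : List ℕ → Set
Twin μ = Σ (List ℕ) λ ν → ν ↭ μ × ν ≢ μ × s ν ≡ s μ

twin-left : ∀ L m R → All (_< m) L → All (_< m) R → Twin L → Twin (L ++ m ∷ R)
twin-left L m R L<m R<m (L′ , L′↭L , L′≢L , sL′≡sL) =
  L′ ++ m ∷ R ,
  ++⁺ʳ (m ∷ R) L′↭L ,
  (λ eq → L′≢L (++-cancelʳ (m ∷ R) L′ L eq)) ,
  (begin
    s (L′ ++ m ∷ R)        ≡⟨ s-split L′ m R (All-resp-↭ (↭-sym L′↭L) L<m) R<m ⟩
    s L′ ++ s R ++ m ∷ []  ≡⟨ cong (_++ s R ++ m ∷ []) sL′≡sL ⟩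
    s L ++ s R ++ m ∷ []   ≡⟨ s-split L m R L<m R<m ⟨
    s (L ++ m ∷ R)         ∎)
  where open ≡-Reasoning

twin-right : ∀ L m R → All (_< m) L → All (_< m) R → Twin R → Twin (L ++ m ∷ R)
twin-right L m R L<m R<m (R′ , R′↭R , R′≢R , sR′≡sR) =
  L ++ m ∷ R′ ,
  ++⁺ˡ L (prep m R′↭R) ,
  (λ eq → R′≢R (∷-injectiveʳ (++-cancelˡ L (m ∷ R′) (m ∷ R) eq))) ,
  (begin
    s (L ++ m ∷ R′)        ≡⟨ s-split L m R′ L<m (All-resp-↭ (↭-sym R′↭R) R<m) ⟩
    s L ++ s R′ ++ m ∷ []  ≡⟨ cong (λ r → s L ++ r ++ m ∷ []) sR′≡sR ⟩
    s L ++ s R ++ m ∷ []   ≡⟨ s-split L m R L<m R<m ⟨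
    s (L ++ m ∷ R)         ∎)
  where open ≡-Reasoning

prefix₂-++ : ∀ X {Y : List ℕ} {b c rest} → X ++ Y ≡ b ∷ c ∷ rest →
  (X ≡ [] × Y ≡ b ∷ c ∷ rest) ⊎ (X ≡ b ∷ [] × Y ≡ c ∷ rest) ⊎ (∃[ r ] X ≡ b ∷ c ∷ r)
prefix₂-++ []          eq   = inj₁ (refl , eq)
prefix₂-++ (_ ∷ [])    refl = inj₂ (inj₁ (refl , refl))
prefix₂-++ (_ ∷ _ ∷ X) refl = inj₂ (inj₂ (X , refl))

-- If the output of μ starts with an ascent b < c, then μ has a twin.  Either
-- the ascent lies inside one subtree, or b and the root m can be exchanged.
initial-ascent-twin : ∀ {μ} → MaxTree μ → ∀ {b c rest} → s μ ≡ b ∷ c ∷ rest → b < c → Twin μ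
initial-ascent-twin (node {L} {R} tL m tR L<m R<m) {b} eq b<c
  with prefix₂-++ (s L) (trans (sym (s-split L m R L<m R<m)) eq)
... | inj₂ (inj₂ (_ , sL≡)) = twin-left L m R L<m R<m (initial-ascent-twin tL sL≡ b<c)
... | inj₂ (inj₁ (sL≡b , sR++m≡))
  with refl ← s-singleton L sL≡b =
  m ∷ b ∷ R , swap m b ↭-refl , (λ eq′ → <⇒≢ b<m (sym (∷-injectiveˡ eq′))) ,
  s-swap-front R b<m R<m (head-below tR (OnHead-prefix {P = b <_} (s R) b<sR++m))
  where
  b<m : b < m
  b<m = All.head L<m
  b<sR++m : OnHead (b <_) (s R ++ m ∷ [])
  b<sR++m = subst (OnHead (b <_)) (sym sR++m≡) b<c
... | inj₁ (sL≡[] , sR++m≡)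
  with refl ← s-empty L sL≡[] | prefix₂-++ (s R) sR++m≡
...   | inj₁ (_ , ())
...   | inj₂ (inj₂ (_ , sR≡)) = twin-right [] m R [] R<m (initial-ascent-twin tR sR≡ b<c)
...   | inj₂ (inj₁ (sR≡b , m≡c))
  with refl ← s-singleton R sR≡b | refl ← ∷-injectiveˡ m≡c =
  b ∷ m ∷ [] , swap b m ↭-refl , (λ eq′ → <⇒≢ b<c (∷-injectiveˡ eq′)) ,
  sym (s-swap-front [] b<c [] tt)

Window : ℕ → ℕ → ℕ → List ℕ → Set
Window a b c xs = ∃[ pre ] ∃[ post ] xs ≡ pre ++ a ∷ b ∷ c ∷ post

data WindowIn++ (a b c : ℕ) (X Y : List ℕ) : Set where
  inLeft    : Window a b c X → WindowIn++ a b c X Y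
  inRight   : Window a b c Y → WindowIn++ a b c X Y
  straddle₁ : ∀ p q → X ≡ p ++ a ∷ [] → Y ≡ b ∷ c ∷ q → WindowIn++ a b c X Y
  straddle₂ : ∀ p q → X ≡ p ++ a ∷ b ∷ [] → Y ≡ c ∷ q → WindowIn++ a b c X Y

window-++ : ∀ {a b c} X {Y} → Window a b c (X ++ Y) → WindowIn++ a b c X Y
window-++ []              w                     = inRight w
window-++ (_ ∷ [])        ([] , post , refl)    = straddle₁ [] post refl refl
window-++ (_ ∷ _ ∷ [])    ([] , post , refl)    = straddle₂ [] post refl refl
window-++ (_ ∷ _ ∷ _ ∷ X) ([] , post , refl)    = inLeft ([] , X , refl)
window-++ (x ∷ X)         (_ ∷ pre , post , eq) with refl , eq′ ← ∷-injective eq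
  with window-++ X (pre , post , eq′)
... | inLeft (p , q , X≡)    = inLeft (x ∷ p , q , cong (x ∷_) X≡)
... | inRight w              = inRight w
... | straddle₁ p q X≡ Y≡    = straddle₁ (x ∷ p) q (cong (x ∷_) X≡) Y≡
... | straddle₂ p q X≡ Y≡    = straddle₂ (x ∷ p) q (cong (x ∷_) X≡) Y≡

window-before-max : ∀ {m a b c} xs → All (_< m) xs → c < a →
  Window a b c (xs ∷ʳ m) → Window a b c xs
window-before-max xs xs<m c<a w with window-++ xs w
... | inLeft w′ = w′
... | inRight ([] , _ , ())
... | inRight (_ ∷ [] , _ , ())
... | inRight (_ ∷ _ ∷ _ , _ , ())
... | straddle₁ _ _ _ ()
... | straddle₂ p _ xs≡ refl with ++⁻ʳ p (subst (All (_< _)) xs≡ xs<m)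
...   | a<m ∷ _ = ⊥-elim (<-asym c<a a<m)

-- With μ = L m R the window lies in s(L) s(R); inside s(L) or s(R) we recurse,
-- if a ends s(L) then b c starts s(R), and a, b cannot end s(L).
window-twin : ∀ {μ a b c} → MaxTree μ → Window a b c (s μ) → b < c → c < a → Twin μ
window-twin leaf ([] , _ , ())
window-twin leaf (_ ∷ _ , _ , ())
window-twin (node {L} {R} tL m tR L<m R<m) w b<c c<a
  with window-++ (s L)
         (window-before-max (s L ++ s R) (s-subtrees-below L m R L<m R<m) c<a
           (subst (Window _ _ _) (s-split-∷ʳ L m R L<m R<m) w))
... | inLeft wL = twin-left L m R L<m R<m (window-twin tL wL b<c c<a)
... | inRight wR = twin-right L m R L<m R<m (window-twin tR wR b<c c<a)
... | straddle₁ _ _ _ sR≡ = twin-right L m R L<m R<m (initial-ascent-twin tR sR≡ b<c)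
... | straddle₂ p _ sL≡ _ = ⊥-elim (<-asym (<-trans b<c c<a) (last-ascent tL p sL≡))

-- Corollary 1: a twin of a preimage of π is a second preimage.
corollary1 : (π : List ℕ) → IsPermutation π →
    (∃[ pre ] ∃[ a ] ∃[ b ] ∃[ c ] ∃[ post ]
      (π ≡ pre ++ a ∷ b ∷ c ∷ post) × b < c × c < a) →
    ¬ UniquelySorted π
corollary1 π _ (pre , a , b , c , post , π≡ , b<c , c<a) (μ , (μ-unique , μ-positive) , sμ≡π , only-μ)
  with ν , ν↭μ , ν≢μ , sν≡sμ ← window-twin (maxTree μ-unique) (pre , post , trans sμ≡π π≡) b<c c<a
  = ν≢μ (only-μ ν (IsPermutation-resp-↭ (↭-sym ν↭μ) (μ-unique , μ-positive)) (trans sν≡sμ sμ≡π))
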